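{- Let $k\ge 2$ and $v\ge 2$ be integers and let \begin{align*} b &= (2v-3)k^2 + (-2v+5)k + (-4v+2),\\ a &= 2k^2-6k+4v,\\ D &= k^4 + (8v^2-16v+2)k^3 + (-8v^3+24v-3)k^2 + (8v^3-8v^2-8v-4)k + 4. \end{align*} If there exists a uniform covering array $\mathrm{UCA}(N;k,v)$, then \[ N \ge v\left(\frac{b+\sqrt{D}}{a}\right). \]
   Context: A (strength-$2$) covering array $\mathrm{CA}(N;k,v)$ is an $N\times k$ array with entries from $\{0,1,\dots,v-1\}$ such that for every choice of two distinct columns $c,c'$ and every pair $(x,y)$ of symbols, there is at least one row with entry $x$ in column $c$ and entry $y$ in column $c'$. It is uniform, written $\mathrm{UCA}(N;k,v)$, if in every column every symbol occurs either $\lfloor N/v\rfloor$ or $\lceil N/v\rceil$ times. -}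

module Defs where

open import Data.Nat using (ℕ; NonZero; _∸_) renaming (_+_ to _+ℕ_)
open import Data.Nat.DivMod using (_/_)
open import Data.Fin using (Fin; _≟_)
open import Data.List using (length; filter; allFin)
open import Data.Product using (∃; _×_)
open import Data.Sum using (_⊎_)
open import Data.Integer using (ℤ; +_; _+_; _-_; _*_; -_)
open import Relation.Binary.PropositionalEquality using (_≡_; _≢_)

Array : ℕ → ℕ → ℕ → Set
Array N k v = Fin N → Fin k → Fin v

IsCoveringArray : (N k v : ℕ) → Array N k v → Set
IsCoveringArray N k v A =
  ∀ (c c′ : Fin k) → c ≢ c′ → ∀ (x y : Fin v) →
    ∃ λ (r : Fin N) → (A r c ≡ x) × (A r c′ ≡ y)

occurrences : {N k v : ℕ} → Array N k v → Fin k → Fin v → ℕ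
occurrences {N} A c x = length (filter (λ r → A r c ≟ x) (allFin N))

ceilDiv : (N v : ℕ) → .{{_ : NonZero v}} → ℕ
ceilDiv N v = (N +ℕ (v ∸ 1)) / v

IsUniform : (N k v : ℕ) → .{{_ : NonZero v}} → Array N k v → Set
IsUniform N k v A =
  ∀ (c : Fin k) (x : Fin v) →
    (occurrences A c x ≡ N / v) ⊎ (occurrences A c x ≡ ceilDiv N v)

IsUCA : (N k v : ℕ) → .{{_ : NonZero v}} → Array N k v → Set
IsUCA N k v A = IsCoveringArray N k v A × IsUniform N k v A

bQ : ℕ → ℕ → ℤ
bQ k v = (+ 2 * + v - + 3) * (+ k * + k) + (- (+ 2 * + v) + + 5) * + k + (- (+ 4 * + v) + + 2)

aQ : ℕ → ℕ → ℤ
aQ k v = + 2 * (+ k * + k) - + 6 * + k + + 4 * + v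

DQ : ℕ → ℕ → ℤ
DQ k v =
  let K = + k ; V = + v in
  K * K * K * K
  + (+ 8 * V * V - + 16 * V + + 2) * (K * K * K)
  + (- (+ 8 * V * V * V) + + 24 * V - + 3) * (K * K)
  + (+ 8 * V * V * V - + 8 * V * V - + 8 * V - + 4) * K
  + + 4

-- Let λ(r, s) be the number of columns in which rows r and s agree. Summed over all pairs of
-- rows, λ and λ² equal Σ_c Σ_x n(c,x)² and Σ_{c,c′} Σ_{x,y} n(c,c′,x,y)², where n counts the rows
-- carrying a symbol in a column, resp. a pair of symbols in a pair of columns. Coverage makes
-- n(c,c′,x,y) ≥ 1 for c ≠ c′, which bounds the second sum by the first; uniformity bounds each
-- Σ_x n(c,x)² by (4N² + v²)/4v. Since λ is an integer and λ(r, r) = k, summing (λ − 1)(λ − 2) ≥ 0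
-- over all pairs of rows yields a quadratic inequality in N, which for k ≥ 3 implies
-- P = aN² − 2bvN + 2(v − 1)((v − 2)k(k − 1) + 2)v² ≥ 0. Finally (aN − vb)² = v²D + aP with a > 0,
-- and aN − vb ≥ 0 because N ≥ v².

module Submission where

open import Defs

open import Data.Bool using (true; false; if_then_else_)
open import Data.Fin using (Fin; zero; suc; punchIn; _≟_)
open import Data.Integer
  using (ℤ; +_; -[1+_]; 0ℤ; 1ℤ; _+_; _-_; _*_; -_; _≤_; +≤+; nonNegative)
open import Data.Integer.Properties hiding (_≟_)
open import Data.Integer.Tactic.RingSolver using (solve-∀)
open import Data.List using (length; filter; tabulate)
open import Data.Nat as ℕ using (ℕ; zero; suc; z≤n; s≤s; NonZero)
import Data.Nat.Properties as ℕP
open import Data.Nat.DivMod using (_/_; /-monoˡ-≤; m/n≡1+[m∸n]/n)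
open import Data.Sum using (inj₁; inj₂)
open import Data.Product using (∃; _×_; _,_; proj₁; proj₂)
open import Function using (_∘_; id)
open import Relation.Binary.PropositionalEquality
open import Relation.Nullary using (Dec; does; yes; no; ¬_)
open import Relation.Nullary.Decidable using (dec-true)
open import Relation.Unary using (Pred; Decidable)

open import Algebra.Properties.Semiring.Sum +-*-semiring
  using (sum; sum-syntax; sum-cong-≗; sum-remove; ∑-distrib-+; ∑-comm; *-distribˡ-sum; *-distribʳ-sum)

0≤+ : ∀ n → 0ℤ ≤ + n
0≤+ n = +≤+ z≤n

+-nonNeg : ∀ {i j} → 0ℤ ≤ i → 0ℤ ≤ j → 0ℤ ≤ i + j
+-nonNeg = +-mono-≤

*-nonNeg : ∀ {i j} → 0ℤ ≤ i → 0ℤ ≤ j → 0ℤ ≤ i * j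
*-nonNeg {+ m} {+ n} _ _ = subst (0ℤ ≤_) (pos-* m n) (0≤+ (m ℕ.* n))

square-nonNeg : ∀ i → 0ℤ ≤ i * i
square-nonNeg (+ n) = *-nonNeg (0≤+ n) (0≤+ n)
square-nonNeg -[1+ n ] = 0≤+ _

consecutive-product-nonNeg : ∀ i → 0ℤ ≤ i * (i + 1ℤ)
consecutive-product-nonNeg (+ n) = *-nonNeg (0≤+ n) (0≤+ (n ℕ.+ 1))
consecutive-product-nonNeg -[1+ n ] =
  subst (0ℤ ≤_) (sym (negated (+ n))) (*-nonNeg (0≤+ (suc n)) (0≤+ n))
  where
  negated : ∀ m → - (1ℤ + m) * (- (1ℤ + m) + 1ℤ) ≡ (1ℤ + m) * m
  negated = solve-∀

≤-by-difference : ∀ {i j d} → 0ℤ ≤ d → j - i ≡ d → i ≤ j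
≤-by-difference 0≤d refl = 0≤i-j⇒j≤i 0≤d

0≤+n-+m : ∀ {m n} → m ℕ.≤ n → 0ℤ ≤ + n - + m
0≤+n-+m = i≤j⇒0≤j-i ∘ +≤+

∑-const : ∀ n x → ∑[ i < n ] x ≡ + n * x
∑-const zero x = sym (*-zeroˡ x)
∑-const (suc n) x = trans (cong (_+_ x) (∑-const n x)) (sym (suc-* (+ n) x))

∑-mono-≤ : ∀ {n} {f g : Fin n → ℤ} → (∀ i → f i ≤ g i) → sum f ≤ sum g
∑-mono-≤ {zero} f≤g = ≤-refl
∑-mono-≤ {suc n} f≤g = +-mono-≤ (f≤g zero) (∑-mono-≤ (f≤g ∘ suc))

∑-nonNeg : ∀ {n} {f : Fin n → ℤ} → (∀ i → 0ℤ ≤ f i) → 0ℤ ≤ sum f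
∑-nonNeg {n} {f} 0≤f = subst (_≤ sum f) (trans (∑-const n 0ℤ) (*-zeroʳ (+ n))) (∑-mono-≤ 0≤f)

∑-affine : ∀ {n} (α β : ℤ) (t : Fin n → ℤ) → ∑[ i < n ] (α * t i + β) ≡ α * sum t + + n * β
∑-affine {n} α β t =
  trans (∑-distrib-+ (λ i → α * t i) (λ _ → β)) (cong₂ _+_ (sym (*-distribˡ-sum α t)) (∑-const n β))

∑-quadratic : ∀ {n} (α β : ℤ) (t : Fin n → ℤ) →
  ∑[ i < n ] (t i * t i + (α * t i + β)) ≡ ∑[ i < n ] (t i * t i) + (α * sum t + + n * β)
∑-quadratic {n} α β t =
  trans (∑-distrib-+ (λ i → t i * t i) (λ i → α * t i + β)) (cong (_+_ (∑[ i < n ] (t i * t i))) (∑-affine α β t))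

term≤∑ : ∀ {n} {f : Fin n → ℤ} → (∀ i → 0ℤ ≤ f i) → ∀ i → f i ≤ sum f
term≤∑ {suc n} {f} 0≤f i =
  subst (f i ≤_) (sym (sum-remove {i = i} f)) (i≤i+j (f i) _ {{nonNegative (∑-nonNeg (0≤f ∘ punchIn i))}})

∑₂-comm : ∀ {m n p} (F : Fin m → Fin n → Fin p → ℤ) →
  ∑[ r < m ] ∑[ s < n ] ∑[ i < p ] F r s i ≡ ∑[ i < p ] ∑[ r < m ] ∑[ s < n ] F r s i
∑₂-comm F = trans (sum-cong-≗ (λ r → ∑-comm (F r))) (∑-comm (λ r i → ∑[ s < _ ] F r s i))

∑₂-product : ∀ {m n} (f : Fin m → ℤ) (g : Fin n → ℤ) →
  ∑[ r < m ] ∑[ s < n ] (f r * g s) ≡ sum f * sum g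
∑₂-product f g = trans (sum-cong-≗ (λ r → sym (*-distribˡ-sum (f r) g)))
                       (sym (*-distribʳ-sum (sum g) f))

gram : ∀ {m p} (u : Fin m → Fin p → ℤ) →
  ∑[ r < m ] ∑[ s < m ] ∑[ i < p ] (u r i * u s i) ≡ ∑[ i < p ] (∑[ r < m ] u r i * ∑[ r < m ] u r i)
gram u = trans (∑₂-comm (λ r s i → u r i * u s i)) (sum-cong-≗ (λ i → ∑₂-product (λ r → u r i) (λ r → u r i)))

∑-square≤square-∑ : ∀ {n} (t : Fin n → ℤ) → (∀ i → 0ℤ ≤ t i) →
  ∑[ i < n ] (t i * t i) ≤ sum t * sum t
∑-square≤square-∑ {zero} t 0≤t = ≤-refl
∑-square≤square-∑ {suc n} t 0≤t =
  ≤-trans (+-monoʳ-≤ (t zero * t zero) (∑-square≤square-∑ (t ∘ suc) (0≤t ∘ suc)))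
          (≤-by-difference (*-nonNeg (*-nonNeg (0≤+ 2) (0≤t zero)) (∑-nonNeg (0≤t ∘ suc)))
                           (cross-term (t zero) (sum (t ∘ suc))))
  where
  cross-term : ∀ a s → (a + s) * (a + s) - (a * a + s * s) ≡ + 2 * a * s
  cross-term = solve-∀

∑-square≤-of-positive : ∀ {n} (t : Fin n → ℤ) → (∀ i → 1ℤ ≤ t i) →
  ∑[ i < n ] (t i * t i) ≤ sum t * sum t - + 2 * (+ n - 1ℤ) * sum t + + n * (+ n - 1ℤ)
∑-square≤-of-positive {n} t 1≤t =
  ≤-by-difference (i≤j⇒0≤j-i (subst₂ _≤_ shifted-squares (cong₂ _*_ shifted-sum shifted-sum)
                                     (∑-square≤square-∑ (λ i → t i - 1ℤ) (i≤j⇒0≤j-i ∘ 1≤t))))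
                  (difference (∑[ i < n ] (t i * t i)) (sum t) (+ n))
  where
  expand : ∀ x → (x - 1ℤ) * (x - 1ℤ) ≡ x * x + (- + 2 * x + 1ℤ)
  expand = solve-∀
  shift : ∀ x → x - 1ℤ ≡ 1ℤ * x + - 1ℤ
  shift = solve-∀
  shifted-squares : ∑[ i < n ] ((t i - 1ℤ) * (t i - 1ℤ)) ≡ ∑[ i < n ] (t i * t i) + (- + 2 * sum t + + n * 1ℤ)
  shifted-squares = trans (sum-cong-≗ (expand ∘ t)) (∑-quadratic (- + 2) 1ℤ t)
  shifted-sum : ∑[ i < n ] (t i - 1ℤ) ≡ 1ℤ * sum t + + n * - 1ℤ
  shifted-sum = trans (sum-cong-≗ (shift ∘ t)) (∑-affine 1ℤ (- 1ℤ) t)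
  difference : ∀ Q T n →
    (T * T - + 2 * (n - 1ℤ) * T + n * (n - 1ℤ)) - Q ≡
    (1ℤ * T + n * - 1ℤ) * (1ℤ * T + n * - 1ℤ) - (Q + (- + 2 * T + n * 1ℤ))
  difference = solve-∀

balanced⇒∑-square-≤ : ∀ {n} (Q : ℤ) (t : Fin n → ℤ) → (∀ i → Q ≤ t i × t i ≤ 1ℤ + Q) →
  + 4 * + n * ∑[ i < n ] (t i * t i) ≤ + 4 * (sum t * sum t) + + n * + n
balanced⇒∑-square-≤ {n} Q t balanced = begin
  + 4 * + n * ∑[ i < n ] (t i * t i)
    ≤⟨ *-monoˡ-≤-nonNeg (+ 4 * + n) {{nonNegative (*-nonNeg (0≤+ 4) (0≤+ n))}} (∑-mono-≤ square≤secant) ⟩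
  + 4 * + n * ∑[ i < n ] (α * t i + β)
    ≡⟨ cong (_*_ (+ 4 * + n)) (∑-affine α β t) ⟩
  + 4 * + n * (α * sum t + + n * β)
    ≤⟨ ≤-by-difference (square-nonNeg (+ 2 * sum t - + n * α)) (completed-square (sum t) (+ n) Q) ⟩
  + 4 * (sum t * sum t) + + n * + n ∎
  where
  open ≤-Reasoning
  α β : ℤ
  α = + 2 * Q + 1ℤ
  β = - (Q * (1ℤ + Q))
  between : ∀ x Q → ((+ 2 * Q + 1ℤ) * x + - (Q * (1ℤ + Q))) - x * x ≡ (x - Q) * ((1ℤ + Q) - x)
  between = solve-∀
  square≤secant : ∀ i → t i * t i ≤ α * t i + β
  square≤secant i = ≤-by-difference
    (*-nonNeg (i≤j⇒0≤j-i (proj₁ (balanced i))) (i≤j⇒0≤j-i (proj₂ (balanced i))))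
    (between (t i) Q)
  completed-square : ∀ T n Q →
    (+ 4 * (T * T) + n * n) - + 4 * n * ((+ 2 * Q + 1ℤ) * T + n * - (Q * (1ℤ + Q)))
      ≡ (+ 2 * T - n * (+ 2 * Q + 1ℤ)) * (+ 2 * T - n * (+ 2 * Q + 1ℤ))
  completed-square = solve-∀

𝟙 : ∀ {p} {P : Set p} → Dec P → ℤ
𝟙 P? = if does P? then 1ℤ else 0ℤ

𝟙-nonNeg : ∀ {p} {P : Set p} (P? : Dec P) → 0ℤ ≤ 𝟙 P?
𝟙-nonNeg P? with does P?
... | true = 0≤+ 1
... | false = 0≤+ 0

count-filter : ∀ {a p} {A : Set a} {P : Pred A p} (P? : Decidable P) {n} (f : Fin n → A) →
  + length (filter P? (tabulate f)) ≡ ∑[ i < n ] 𝟙 (P? (f i))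
count-filter P? {zero} f = refl
count-filter P? {suc n} f with does (P? (f zero))
... | true = cong (_+_ 1ℤ) (count-filter P? (f ∘ suc))
... | false = trans (count-filter P? (f ∘ suc)) (sym (+-identityˡ _))

δ : ∀ {n} → Fin n → Fin n → ℤ
δ i j = 𝟙 (i ≟ j)

δ-≡ : ∀ {n} {i j : Fin n} → i ≡ j → δ i j ≡ 1ℤ
δ-≡ {i = i} refl rewrite dec-true (i ≟ i) refl = refl

∑-δ-* : ∀ {n} (i : Fin n) (g : Fin n → ℤ) → ∑[ j < n ] (δ i j * g j) ≡ g i
∑-δ-* {suc n} zero g =
  trans (cong₂ _+_ (*-identityˡ (g zero)) (trans (∑-const n 0ℤ) (*-zeroʳ (+ n)))) (+-identityʳ (g zero))
∑-δ-* (suc i) g = trans (+-identityˡ _) (∑-δ-* i (g ∘ suc))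

∑-δ : ∀ {n} (i : Fin n) → ∑[ j < n ] δ i j ≡ 1ℤ
∑-δ i = trans (sum-cong-≗ (λ j → sym (*-identityʳ (δ i j)))) (∑-δ-* i (λ _ → 1ℤ))

δ-expand : ∀ {n} (a b : Fin n) → δ a b ≡ ∑[ x < n ] (δ a x * δ b x)
δ-expand a b = sym (trans (sum-cong-≗ (λ x → *-comm (δ a x) (δ b x))) (∑-δ-* b (δ a)))

δ-product-expand : ∀ {n} (a b a′ b′ : Fin n) →
  δ a b * δ a′ b′ ≡ ∑[ x < n ] ∑[ y < n ] ((δ a x * δ a′ y) * (δ b x * δ b′ y))
δ-product-expand {n} a b a′ b′ = begin
  δ a b * δ a′ b′
    ≡⟨ cong₂ _*_ (δ-expand a b) (δ-expand a′ b′) ⟩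
  ∑[ x < n ] (δ a x * δ b x) * ∑[ y < n ] (δ a′ y * δ b′ y)
    ≡⟨ ∑₂-product (λ x → δ a x * δ b x) (λ y → δ a′ y * δ b′ y) ⟨
  ∑[ x < n ] ∑[ y < n ] ((δ a x * δ b x) * (δ a′ y * δ b′ y))
    ≡⟨ sum-cong-≗ (λ x → sum-cong-≗ (λ y → interchange (δ a x) (δ b x) (δ a′ y) (δ b′ y))) ⟩
  ∑[ x < n ] ∑[ y < n ] ((δ a x * δ a′ y) * (δ b x * δ b′ y)) ∎
  where
  open ≡-Reasoning
  interchange : ∀ p q r s → (p * q) * (r * s) ≡ (p * r) * (q * s)
  interchange = solve-∀

/≤ceilDiv : ∀ N v .{{_ : NonZero v}} → N / v ℕ.≤ ceilDiv N v
/≤ceilDiv N v = /-monoˡ-≤ v (ℕP.m≤m+n N (v ℕ.∸ 1))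

ceilDiv≤1+/ : ∀ N v .{{_ : NonZero v}} → ceilDiv N v ℕ.≤ suc (N / v)
ceilDiv≤1+/ N v = ℕP.≤-trans (/-monoˡ-≤ v (ℕP.+-monoʳ-≤ N (ℕP.m∸n≤m v 1)))
  (ℕP.≤-reflexive (trans (m/n≡1+[m∸n]/n (ℕP.m≤n+m v N)) (cong (λ m → suc (m / v)) (ℕP.m+n∸n≡m N v))))

pairSlack : ℕ → ℕ → ℤ
pairSlack v N = + v * (+ v * (+ v - 1ℤ)) - + 2 * (+ v - 1ℤ) * + N

CountingBound : ℕ → ℕ → ℕ → Set
CountingBound k v N =
  + 4 * + v * + N * ((+ k - 1ℤ) * (+ k - + 2))
    ≤ + k * (+ k - + 3) * (+ 4 * (+ N * + N) + + v * + v)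
      + + 4 * + v * + k * (+ k - 1ℤ) * pairSlack v N + + 8 * + v * (+ N * + N)

module _ {N k v : ℕ} (A : Array N k v) where

  freq : Fin k → Fin v → ℤ
  freq c x = ∑[ r < N ] δ (A r c) x

  pairFreq : Fin k → Fin k → Fin v → Fin v → ℤ
  pairFreq c c′ x y = ∑[ r < N ] (δ (A r c) x * δ (A r c′) y)

  agreement : Fin N → Fin N → ℤ
  agreement r s = ∑[ c < k ] δ (A r c) (A s c)

  freqSquares : Fin k → ℤ
  freqSquares c = ∑[ x < v ] (freq c x * freq c x)

  pairFreqSquares : Fin k → Fin k → ℤ
  pairFreqSquares c c′ = ∑[ x < v ] ∑[ y < v ] (pairFreq c c′ x y * pairFreq c c′ x y)

  occurrences≡freq : ∀ c x → + occurrences A c x ≡ freq c x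
  occurrences≡freq c x = count-filter (λ r → A r c ≟ x) id

  ∑-freq : ∀ c → ∑[ x < v ] freq c x ≡ + N
  ∑-freq c = begin
    ∑[ x < v ] ∑[ r < N ] δ (A r c) x
      ≡⟨ ∑-comm (λ x r → δ (A r c) x) ⟩
    ∑[ r < N ] ∑[ x < v ] δ (A r c) x
      ≡⟨ sum-cong-≗ (λ r → ∑-δ (A r c)) ⟩
    ∑[ r < N ] 1ℤ
      ≡⟨ ∑-const N 1ℤ ⟩
    + N * 1ℤ
      ≡⟨ *-identityʳ (+ N) ⟩
    + N ∎
    where open ≡-Reasoning

  ∑-pairFreq : ∀ c c′ x → ∑[ y < v ] pairFreq c c′ x y ≡ freq c x
  ∑-pairFreq c c′ x = begin
    ∑[ y < v ] ∑[ r < N ] (δ (A r c) x * δ (A r c′) y)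
      ≡⟨ ∑-comm (λ y r → δ (A r c) x * δ (A r c′) y) ⟩
    ∑[ r < N ] ∑[ y < v ] (δ (A r c) x * δ (A r c′) y)
      ≡⟨ sum-cong-≗ (λ r → sym (*-distribˡ-sum (δ (A r c) x) (δ (A r c′)))) ⟩
    ∑[ r < N ] (δ (A r c) x * ∑[ y < v ] δ (A r c′) y)
      ≡⟨ sum-cong-≗ (λ r → cong (_*_ (δ (A r c) x)) (∑-δ (A r c′))) ⟩
    ∑[ r < N ] (δ (A r c) x * 1ℤ)
      ≡⟨ sum-cong-≗ (λ r → *-identityʳ (δ (A r c) x)) ⟩
    freq c x ∎
    where open ≡-Reasoning

  pairFreq-nonNeg : ∀ c c′ x y → 0ℤ ≤ pairFreq c c′ x y
  pairFreq-nonNeg c c′ x y = ∑-nonNeg (λ r → *-nonNeg (𝟙-nonNeg (A r c ≟ x)) (𝟙-nonNeg (A r c′ ≟ y)))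

  covering⇒pairFreq-positive : IsCoveringArray N k v A →
    ∀ {c c′} → ¬ c ≡ c′ → ∀ x y → 1ℤ ≤ pairFreq c c′ x y
  covering⇒pairFreq-positive covering {c} {c′} c≢c′ x y with covering c c′ c≢c′ x y
  ... | r , Arc≡x , Arc′≡y =
    subst (_≤ pairFreq c c′ x y) (cong₂ _*_ (δ-≡ Arc≡x) (δ-≡ Arc′≡y))
          (term≤∑ (λ r → *-nonNeg (𝟙-nonNeg (A r c ≟ x)) (𝟙-nonNeg (A r c′ ≟ y))) r)

  agreement-self : ∀ r → agreement r r ≡ + k
  agreement-self r =
    trans (sum-cong-≗ (λ c → δ-≡ {i = A r c} refl)) (trans (∑-const k 1ℤ) (*-identityʳ (+ k)))

  ∑-agreement : ∑[ r < N ] ∑[ s < N ] agreement r s ≡ ∑[ c < k ] freqSquares c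
  ∑-agreement = begin
    ∑[ r < N ] ∑[ s < N ] ∑[ c < k ] δ (A r c) (A s c)
      ≡⟨ sum-cong-≗ (λ r → sum-cong-≗ (λ s → sum-cong-≗ (λ c → δ-expand (A r c) (A s c)))) ⟩
    ∑[ r < N ] ∑[ s < N ] ∑[ c < k ] ∑[ x < v ] (δ (A r c) x * δ (A s c) x)
      ≡⟨ ∑₂-comm (λ r s c → ∑[ x < v ] (δ (A r c) x * δ (A s c) x)) ⟩
    ∑[ c < k ] ∑[ r < N ] ∑[ s < N ] ∑[ x < v ] (δ (A r c) x * δ (A s c) x)
      ≡⟨ sum-cong-≗ (λ c → gram (λ r x → δ (A r c) x)) ⟩
    ∑[ c < k ] freqSquares c ∎
    where open ≡-Reasoning

  ∑-agreement² : ∑[ r < N ] ∑[ s < N ] (agreement r s * agreement r s) ≡ ∑[ c < k ] ∑[ c′ < k ] pairFreqSquares c c′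
  ∑-agreement² = begin
    ∑[ r < N ] ∑[ s < N ] (agreement r s * agreement r s)
      ≡⟨ sum-cong-≗ (λ r → sum-cong-≗ (λ s → square-expand r s)) ⟩
    ∑[ r < N ] ∑[ s < N ] ∑[ c < k ] ∑[ c′ < k ] ∑[ x < v ] ∑[ y < v ] (u r c c′ x y * u s c c′ x y)
      ≡⟨ ∑₂-comm (λ r s c → ∑[ c′ < k ] ∑[ x < v ] ∑[ y < v ] (u r c c′ x y * u s c c′ x y)) ⟩
    ∑[ c < k ] ∑[ r < N ] ∑[ s < N ] ∑[ c′ < k ] ∑[ x < v ] ∑[ y < v ] (u r c c′ x y * u s c c′ x y)
      ≡⟨ sum-cong-≗ (λ c →
           trans (∑₂-comm (λ r s c′ → ∑[ x < v ] ∑[ y < v ] (u r c c′ x y * u s c c′ x y)))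
                 (sum-cong-≗ (λ c′ →
           trans (∑₂-comm (λ r s x → ∑[ y < v ] (u r c c′ x y * u s c c′ x y)))
                 (sum-cong-≗ (λ x → gram (λ r y → u r c c′ x y)))))) ⟩
    ∑[ c < k ] ∑[ c′ < k ] pairFreqSquares c c′ ∎
    where
    open ≡-Reasoning
    u : Fin N → Fin k → Fin k → Fin v → Fin v → ℤ
    u r c c′ x y = δ (A r c) x * δ (A r c′) y
    square-expand : ∀ r s → agreement r s * agreement r s ≡
      ∑[ c < k ] ∑[ c′ < k ] ∑[ x < v ] ∑[ y < v ] (u r c c′ x y * u s c c′ x y)
    square-expand r s =
      trans (sym (∑₂-product (λ c → δ (A r c) (A s c)) (λ c′ → δ (A r c′) (A s c′))))
            (sum-cong-≗ (λ c → sum-cong-≗ (λ c′ → δ-product-expand (A r c) (A s c) (A r c′) (A s c′))))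

  pairFreqSquares-diagonal : ∀ c → pairFreqSquares c c ≤ freqSquares c
  pairFreqSquares-diagonal c = ∑-mono-≤ (λ x →
    subst (pairFreqSquares-row x ≤_) (cong₂ _*_ (∑-pairFreq c c x) (∑-pairFreq c c x))
          (∑-square≤square-∑ (pairFreq c c x) (pairFreq-nonNeg c c x)))
    where
    pairFreqSquares-row : Fin v → ℤ
    pairFreqSquares-row x = ∑[ y < v ] (pairFreq c c x y * pairFreq c c x y)

  pairFreqSquares-distinct : IsCoveringArray N k v A → ∀ {c c′} → ¬ c ≡ c′ →
    pairFreqSquares c c′ ≤ freqSquares c + pairSlack v N
  pairFreqSquares-distinct covering {c} {c′} c≢c′ =
    subst (pairFreqSquares c c′ ≤_) summed (∑-mono-≤ (λ x →
      subst (pairFreqSquares-row x ≤_) (cong bound (∑-pairFreq c c′ x))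
            (∑-square≤-of-positive (pairFreq c c′ x) (covering⇒pairFreq-positive covering c≢c′ x))))
    where
    pairFreqSquares-row : Fin v → ℤ
    pairFreqSquares-row x = ∑[ y < v ] (pairFreq c c′ x y * pairFreq c c′ x y)
    bound : ℤ → ℤ
    bound T = T * T - + 2 * (+ v - 1ℤ) * T + + v * (+ v - 1ℤ)
    α β : ℤ
    α = - (+ 2 * (+ v - 1ℤ))
    β = + v * (+ v - 1ℤ)
    bound-quadratic : ∀ T V → T * T - + 2 * (V - 1ℤ) * T + V * (V - 1ℤ) ≡ T * T + (- (+ 2 * (V - 1ℤ)) * T + V * (V - 1ℤ))
    bound-quadratic = solve-∀
    slack : ∀ S V N → S + (- (+ 2 * (V - 1ℤ)) * N + V * (V * (V - 1ℤ))) ≡ S + (V * (V * (V - 1ℤ)) - + 2 * (V - 1ℤ) * N)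
    slack = solve-∀
    summed : ∑[ x < v ] bound (freq c x) ≡ freqSquares c + pairSlack v N
    summed = begin
      ∑[ x < v ] bound (freq c x)
        ≡⟨ sum-cong-≗ (λ x → bound-quadratic (freq c x) (+ v)) ⟩
      ∑[ x < v ] (freq c x * freq c x + (α * freq c x + β))
        ≡⟨ ∑-quadratic α β (freq c) ⟩
      freqSquares c + (α * ∑[ x < v ] freq c x + + v * β)
        ≡⟨ cong (λ n → freqSquares c + (α * n + + v * β)) (∑-freq c) ⟩
      freqSquares c + (α * + N + + v * β)
        ≡⟨ slack (freqSquares c) (+ v) (+ N) ⟩
      freqSquares c + pairSlack v N ∎
      where open ≡-Reasoning

  pairFreqSquares-≤ : IsCoveringArray N k v A → ∀ c c′ →
    pairFreqSquares c c′ ≤ freqSquares c + (1ℤ - δ c c′) * pairSlack v N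
  pairFreqSquares-≤ covering c c′ with c ≟ c′
  ... | yes refl = subst (pairFreqSquares c c ≤_) (sym (+-identityʳ (freqSquares c))) (pairFreqSquares-diagonal c)
  ... | no c≢c′ = subst (λ b → pairFreqSquares c c′ ≤ freqSquares c + b) (sym (*-identityˡ (pairSlack v N)))
                        (pairFreqSquares-distinct covering c≢c′)

  ∑-agreement²-≤ : IsCoveringArray N k v A →
    ∑[ r < N ] ∑[ s < N ] (agreement r s * agreement r s)
      ≤ + k * ∑[ c < k ] freqSquares c + + k * (+ k - 1ℤ) * pairSlack v N
  ∑-agreement²-≤ covering = begin
    ∑[ r < N ] ∑[ s < N ] (agreement r s * agreement r s)
      ≡⟨ ∑-agreement² ⟩
    ∑[ c < k ] ∑[ c′ < k ] pairFreqSquares c c′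
      ≤⟨ ∑-mono-≤ (λ c → ∑-mono-≤ (pairFreqSquares-≤ covering c)) ⟩
    ∑[ c < k ] ∑[ c′ < k ] (freqSquares c + (1ℤ - δ c c′) * H)
      ≡⟨ sum-cong-≗ row ⟩
    ∑[ c < k ] (+ k * freqSquares c + (+ k * H - H))
      ≡⟨ ∑-affine (+ k) (+ k * H - H) freqSquares ⟩
    + k * ∑[ c < k ] freqSquares c + + k * (+ k * H - H)
      ≡⟨ regroup (+ k) (∑[ c < k ] freqSquares c) H ⟩
    + k * ∑[ c < k ] freqSquares c + + k * (+ k - 1ℤ) * H ∎
    where
    open ≤-Reasoning
    H : ℤ
    H = pairSlack v N
    pointwise : ∀ S H d → S + (1ℤ - d) * H ≡ - H * d + (S + H)
    pointwise = solve-∀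
    collect : ∀ S H K → - H * 1ℤ + K * (S + H) ≡ K * S + (K * H - H)
    collect = solve-∀
    regroup : ∀ K Σ H → K * Σ + K * (K * H - H) ≡ K * Σ + K * (K - 1ℤ) * H
    regroup = solve-∀
    row : ∀ c → ∑[ c′ < k ] (freqSquares c + (1ℤ - δ c c′) * H) ≡ + k * freqSquares c + (+ k * H - H)
    row c = begin-equality
      ∑[ c′ < k ] (freqSquares c + (1ℤ - δ c c′) * H)
        ≡⟨ sum-cong-≗ (λ c′ → pointwise (freqSquares c) H (δ c c′)) ⟩
      ∑[ c′ < k ] (- H * δ c c′ + (freqSquares c + H))
        ≡⟨ ∑-affine (- H) (freqSquares c + H) (δ c) ⟩
      - H * ∑[ c′ < k ] δ c c′ + + k * (freqSquares c + H)
        ≡⟨ cong (λ n → - H * n + + k * (freqSquares c + H)) (∑-δ c) ⟩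
      - H * 1ℤ + + k * (freqSquares c + H)
        ≡⟨ collect (freqSquares c) H (+ k) ⟩
      + k * freqSquares c + (+ k * H - H) ∎

  agreement-pointwise : ∀ r s →
    δ r s * ((+ k - 1ℤ) * (+ k - + 2)) ≤ (agreement r s - 1ℤ) * (agreement r s - + 2)
  agreement-pointwise r s with r ≟ s
  ... | yes refl = ≤-reflexive (trans (*-identityˡ _) (cong (λ a → (a - 1ℤ) * (a - + 2)) (sym (agreement-self r))))
  ... | no _ = subst (0ℤ ≤_) (sym (shift (agreement r s))) (consecutive-product-nonNeg (agreement r s - + 2))
    where
    shift : ∀ a → (a - 1ℤ) * (a - + 2) ≡ (a - + 2) * ((a - + 2) + 1ℤ)
    shift = solve-∀

  covering⇒agreement-inequality : IsCoveringArray N k v A →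
    + N * ((+ k - 1ℤ) * (+ k - + 2))
      ≤ (+ k - + 3) * ∑[ c < k ] freqSquares c + + k * (+ k - 1ℤ) * pairSlack v N + + 2 * (+ N * + N)
  covering⇒agreement-inequality covering = begin
    + N * Kc
      ≡⟨ ∑-const N Kc ⟨
    ∑[ r < N ] Kc
      ≡⟨ sum-cong-≗ {N} (λ r → ∑-δ-* {N} r (λ _ → Kc)) ⟨
    ∑[ r < N ] ∑[ s < N ] (δ r s * Kc)
      ≤⟨ ∑-mono-≤ (λ r → ∑-mono-≤ (agreement-pointwise r)) ⟩
    ∑[ r < N ] ∑[ s < N ] ((agreement r s - 1ℤ) * (agreement r s - + 2))
      ≡⟨ moments ⟩
    L₂ + (- + 3 * L₁ + + N * (+ N * + 2))
      ≤⟨ +-mono-≤ (∑-agreement²-≤ covering) (≤-reflexive (cong (λ l → - + 3 * l + + N * (+ N * + 2)) ∑-agreement)) ⟩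
    (+ k * Σ + + k * (+ k - 1ℤ) * H) + (- + 3 * Σ + + N * (+ N * + 2))
      ≡⟨ regroup (+ k) (+ N) Σ H ⟩
    (+ k - + 3) * Σ + + k * (+ k - 1ℤ) * H + + 2 * (+ N * + N) ∎
    where
    open ≤-Reasoning
    Kc Σ H L₁ L₂ : ℤ
    Kc = (+ k - 1ℤ) * (+ k - + 2)
    Σ = ∑[ c < k ] freqSquares c
    H = pairSlack v N
    L₁ = ∑[ r < N ] ∑[ s < N ] agreement r s
    L₂ = ∑[ r < N ] ∑[ s < N ] (agreement r s * agreement r s)
    expand : ∀ a → (a - 1ℤ) * (a - + 2) ≡ a * a + (- + 3 * a + + 2)
    expand = solve-∀
    regroup : ∀ K N Σ H → (K * Σ + K * (K - 1ℤ) * H) + (- + 3 * Σ + N * (N * + 2)) ≡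
                          (K - + 3) * Σ + K * (K - 1ℤ) * H + + 2 * (N * N)
    regroup = solve-∀
    moments : ∑[ r < N ] ∑[ s < N ] ((agreement r s - 1ℤ) * (agreement r s - + 2)) ≡ L₂ + (- + 3 * L₁ + + N * (+ N * + 2))
    moments = begin-equality
      ∑[ r < N ] ∑[ s < N ] ((agreement r s - 1ℤ) * (agreement r s - + 2))
        ≡⟨ sum-cong-≗ (λ r → trans (sum-cong-≗ (expand ∘ agreement r)) (∑-quadratic (- + 3) (+ 2) (agreement r))) ⟩
      ∑[ r < N ] (∑[ s < N ] (agreement r s * agreement r s) + (- + 3 * ∑[ s < N ] agreement r s + + N * + 2))
        ≡⟨ ∑-distrib-+ (λ r → ∑[ s < N ] (agreement r s * agreement r s)) _ ⟩
      L₂ + ∑[ r < N ] (- + 3 * ∑[ s < N ] agreement r s + + N * + 2)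
        ≡⟨ cong (_+_ L₂) (∑-affine (- + 3) (+ N * + 2) (λ r → ∑[ s < N ] agreement r s)) ⟩
      L₂ + (- + 3 * L₁ + + N * (+ N * + 2)) ∎

  uniform⇒freq-balanced : .{{_ : NonZero v}} → IsUniform N k v A →
    ∀ c x → + (N / v) ≤ freq c x × freq c x ≤ 1ℤ + + (N / v)
  uniform⇒freq-balanced uniform c x with uniform c x
  ... | inj₁ occ≡⌊N/v⌋ = subst (λ f → + (N / v) ≤ f × f ≤ 1ℤ + + (N / v))
                               (trans (cong +_ (sym occ≡⌊N/v⌋)) (occurrences≡freq c x))
                               (≤-refl , +≤+ (ℕP.n≤1+n (N / v)))
  ... | inj₂ occ≡⌈N/v⌉ = subst (λ f → + (N / v) ≤ f × f ≤ 1ℤ + + (N / v))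
                               (trans (cong +_ (sym occ≡⌈N/v⌉)) (occurrences≡freq c x))
                               (+≤+ (/≤ceilDiv N v) , +≤+ (ceilDiv≤1+/ N v))

  uniform⇒freqSquares-≤ : .{{_ : NonZero v}} → IsUniform N k v A →
    ∀ c → + 4 * + v * freqSquares c ≤ + 4 * (+ N * + N) + + v * + v
  uniform⇒freqSquares-≤ uniform c =
    subst (λ T → + 4 * + v * freqSquares c ≤ + 4 * (T * T) + + v * + v) (∑-freq c)
          (balanced⇒∑-square-≤ (+ (N / v)) (freq c) (uniform⇒freq-balanced uniform c))

  uniform⇒∑-freqSquares-≤ : .{{_ : NonZero v}} → IsUniform N k v A →
    + 4 * + v * ∑[ c < k ] freqSquares c ≤ + k * (+ 4 * (+ N * + N) + + v * + v)
  uniform⇒∑-freqSquares-≤ uniform = begin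
    + 4 * + v * ∑[ c < k ] freqSquares c
      ≡⟨ *-distribˡ-sum (+ 4 * + v) freqSquares ⟩
    ∑[ c < k ] (+ 4 * + v * freqSquares c)
      ≤⟨ ∑-mono-≤ (uniform⇒freqSquares-≤ uniform) ⟩
    ∑[ c < k ] (+ 4 * (+ N * + N) + + v * + v)
      ≡⟨ ∑-const k _ ⟩
    + k * (+ 4 * (+ N * + N) + + v * + v) ∎
    where open ≤-Reasoning

  distinct-columns⇒v²≤N : IsCoveringArray N k v A → ∀ {c c′} → ¬ c ≡ c′ → + v * + v ≤ + N
  distinct-columns⇒v²≤N covering {c} {c′} c≢c′ = begin
    + v * + v
      ≡⟨ cong (_*_ (+ v)) (*-identityʳ (+ v)) ⟨
    + v * (+ v * 1ℤ)
      ≡⟨ ∑-const v (+ v * 1ℤ) ⟨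
    ∑[ x < v ] (+ v * 1ℤ)
      ≡⟨ sum-cong-≗ {v} (λ _ → ∑-const v 1ℤ) ⟨
    ∑[ x < v ] ∑[ y < v ] 1ℤ
      ≤⟨ ∑-mono-≤ (λ x → ∑-mono-≤ (covering⇒pairFreq-positive covering c≢c′ x)) ⟩
    ∑[ x < v ] ∑[ y < v ] pairFreq c c′ x y
      ≡⟨ sum-cong-≗ (∑-pairFreq c c′) ⟩
    ∑[ x < v ] freq c x
      ≡⟨ ∑-freq c ⟩
    + N ∎
    where open ≤-Reasoning

  uca⇒countingBound : .{{_ : NonZero v}} → IsUCA N k v A → 3 ℕ.≤ k → CountingBound k v N
  uca⇒countingBound (covering , uniform) 3≤k = begin
    + 4 * + v * + N * Kc
      ≡⟨ *-assoc (+ 4 * + v) (+ N) Kc ⟩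
    + 4 * + v * (+ N * Kc)
      ≤⟨ *-monoˡ-≤-nonNeg (+ 4 * + v) {{nonNegative (*-nonNeg (0≤+ 4) (0≤+ v))}}
                          (covering⇒agreement-inequality covering) ⟩
    + 4 * + v * ((+ k - + 3) * Σ + + k * (+ k - 1ℤ) * H + + 2 * (+ N * + N))
      ≡⟨ distribute (+ k) (+ v) (+ N) Σ H ⟩
    (+ k - + 3) * (+ 4 * + v * Σ) + + 4 * + v * + k * (+ k - 1ℤ) * H + + 8 * + v * (+ N * + N)
      ≤⟨ +-monoˡ-≤ _ (+-monoˡ-≤ _ (*-monoˡ-≤-nonNeg (+ k - + 3) {{nonNegative (i≤j⇒0≤j-i (+≤+ 3≤k))}}
                                                    (uniform⇒∑-freqSquares-≤ uniform))) ⟩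
    (+ k - + 3) * (+ k * (+ 4 * (+ N * + N) + + v * + v)) + + 4 * + v * + k * (+ k - 1ℤ) * H + + 8 * + v * (+ N * + N)
      ≡⟨ cong (λ a → a + + 4 * + v * + k * (+ k - 1ℤ) * H + + 8 * + v * (+ N * + N))
              (reassociate (+ k) (+ 4 * (+ N * + N) + + v * + v)) ⟩
    + k * (+ k - + 3) * (+ 4 * (+ N * + N) + + v * + v) + + 4 * + v * + k * (+ k - 1ℤ) * H + + 8 * + v * (+ N * + N) ∎
    where
    open ≤-Reasoning
    Kc Σ H : ℤ
    Kc = (+ k - 1ℤ) * (+ k - + 2)
    Σ = ∑[ c < k ] freqSquares c
    H = pairSlack v N
    distribute : ∀ K V N Σ H →
      + 4 * V * ((K - + 3) * Σ + K * (K - 1ℤ) * H + + 2 * (N * N))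
        ≡ (K - + 3) * (+ 4 * V * Σ) + + 4 * V * K * (K - 1ℤ) * H + + 8 * V * (N * N)
    distribute = solve-∀
    reassociate : ∀ K X → (K - + 3) * (K * X) ≡ K * (K - + 3) * X
    reassociate = solve-∀

margin : ℕ → ℕ → ℕ → ℤ
margin k v N = + N * aQ k v - + v * bQ k v

quadraticForm : ℕ → ℕ → ℕ → ℤ
quadraticForm k v N =
  aQ k v * (+ N * + N) - + 2 * bQ k v * + v * + N
    + + 2 * (+ v - 1ℤ) * ((+ v - + 2) * + k * (+ k - 1ℤ) + + 2) * (+ v * + v)

margin-square : ∀ k v N → margin k v N * margin k v N ≡ + v * + v * DQ k v + aQ k v * quadraticForm k v N
margin-square k v N = identity (+ k) (+ v) (+ N)
  where
  identity : ∀ K V N →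
    let a = + 2 * (K * K) - + 6 * K + + 4 * V
        b = (+ 2 * V - + 3) * (K * K) + (- (+ 2 * V) + + 5) * K + (- (+ 4 * V) + + 2)
        D = K * K * K * K
            + (+ 8 * V * V - + 16 * V + + 2) * (K * K * K)
            + (- (+ 8 * V * V * V) + + 24 * V - + 3) * (K * K)
            + (+ 8 * V * V * V - + 8 * V * V - + 8 * V - + 4) * K
            + + 4
    in (N * a - V * b) * (N * a - V * b)
         ≡ V * V * D + a * (a * (N * N) - + 2 * b * V * N + + 2 * (V - 1ℤ) * ((V - + 2) * K * (K - 1ℤ) + + 2) * (V * V))
  identity = solve-∀

aQ-nonNeg : ∀ {k v} → 2 ℕ.≤ k → 1 ℕ.≤ v → 0ℤ ≤ aQ k v
aQ-nonNeg {k} {v} 2≤k 1≤v =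
  subst (0ℤ ≤_) (sym (factorise (+ k) (+ v)))
        (+-nonNeg (*-nonNeg (*-nonNeg (0≤+ 2) (0≤+n-+m 2≤k)) (0≤+n-+m (ℕP.<⇒≤ 2≤k)))
                  (*-nonNeg (0≤+ 4) (0≤+n-+m 1≤v)))
  where
  factorise : ∀ K V → + 2 * (K * K) - + 6 * K + + 4 * V ≡ + 2 * (K - + 2) * (K - 1ℤ) + + 4 * (V - 1ℤ)
  factorise = solve-∀

margin-nonNeg : ∀ {k v N} → 2 ℕ.≤ k → 1 ℕ.≤ v → + v * + v ≤ + N → 0ℤ ≤ margin k v N
margin-nonNeg {k} {v} {N} 2≤k 1≤v v²≤N =
  subst (0ℤ ≤_) (sym (decompose (+ k) (+ v) (+ N)))
        (+-nonNeg (*-nonNeg (aQ-nonNeg 2≤k 1≤v) (i≤j⇒0≤j-i v²≤N))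
                  (*-nonNeg (0≤+ v) (+-nonNeg (+-nonNeg (square-nonNeg (+ k - + 2 * + v))
                                                        (*-nonNeg k-2≥0 (+-nonNeg (*-nonNeg (0≤+ 2) k-2≥0) (0≤+ 3))))
                                              (*-nonNeg (0≤+ 4) (0≤+n-+m 1≤v)))))
  where
  k-2≥0 : 0ℤ ≤ + k - + 2
  k-2≥0 = 0≤+n-+m 2≤k
  decompose : ∀ K V N →
    let a = + 2 * (K * K) - + 6 * K + + 4 * V
        b = (+ 2 * V - + 3) * (K * K) + (- (+ 2 * V) + + 5) * K + (- (+ 4 * V) + + 2)
    in N * a - V * b
         ≡ a * (N - V * V) + V * ((K - + 2 * V) * (K - + 2 * V) + (K - + 2) * (+ 2 * (K - + 2) + + 3) + + 4 * (V - 1ℤ))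
  decompose = solve-∀

-- For k = 2 the counting bound is useless (its factor k − 3 is negative), but there b = 0 and P factors.
quadraticForm-nonNeg-2 : ∀ {v} N → 1 ℕ.≤ v → 0ℤ ≤ quadraticForm 2 v N
quadraticForm-nonNeg-2 {v} N 1≤v =
  subst (0ℤ ≤_) (sym (factorise (+ v) (+ N)))
        (*-nonNeg (*-nonNeg (0≤+ 4) v-1≥0) (+-nonNeg (square-nonNeg (+ N)) (*-nonNeg v-1≥0 (square-nonNeg (+ v)))))
  where
  v-1≥0 : 0ℤ ≤ + v - 1ℤ
  v-1≥0 = 0≤+n-+m 1≤v
  factorise : ∀ V N →
    let a = + 2 * (+ 2 * + 2) - + 6 * + 2 + + 4 * V
        b = (+ 2 * V - + 3) * (+ 2 * + 2) + (- (+ 2 * V) + + 5) * + 2 + (- (+ 4 * V) + + 2)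
    in a * (N * N) - + 2 * b * V * N + + 2 * (V - 1ℤ) * ((V - + 2) * + 2 * (+ 2 - 1ℤ) + + 2) * (V * V)
         ≡ + 4 * (V - 1ℤ) * (N * N + (V - 1ℤ) * (V * V))
  factorise = solve-∀

countingBound⇒quadraticForm-nonNeg : ∀ {k v N} → 3 ℕ.≤ k → + v * + v ≤ + N → CountingBound k v N →
  0ℤ ≤ quadraticForm k v N
countingBound⇒quadraticForm-nonNeg {k} {v} {N} 3≤k v²≤N bound =
  *-cancelˡ-≤-pos 0ℤ (quadraticForm k v N) (+ 2) (subst (0ℤ ≤_) (sym (certificate (+ k) (+ v) (+ N)))
    (+-nonNeg (+-nonNeg (i≤j⇒0≤j-i bound) (*-nonNeg linear-coefficient≥0 (i≤j⇒0≤j-i v²≤N)))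
              (*-nonNeg (square-nonNeg (+ v)) constant-coefficient≥0)))
  where
  k-3≥0 : 0ℤ ≤ + k - + 3
  k-3≥0 = 0≤+n-+m 3≤k
  linear-coefficient≥0 : 0ℤ ≤ + 4 * (+ 2 * + k * (+ k - + 3) + + 4 * + v) * + v
  linear-coefficient≥0 =
    *-nonNeg (*-nonNeg (0≤+ 4) (+-nonNeg (*-nonNeg (*-nonNeg (0≤+ 2) (0≤+ k)) k-3≥0) (*-nonNeg (0≤+ 4) (0≤+ v))))
             (0≤+ v)
  constant-coefficient≥0 : 0ℤ ≤ (+ 2 * + k - + 4 * + v) * (+ 2 * + k - + 4 * + v)
                                 + + 3 * ((+ k - + 3) * (+ k - + 3)) + + 13 * (+ k - + 3) + (+ 4 + + 8 * + v)
  constant-coefficient≥0 =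
    +-nonNeg (+-nonNeg (+-nonNeg (square-nonNeg (+ 2 * + k - + 4 * + v)) (*-nonNeg (0≤+ 3) (square-nonNeg (+ k - + 3))))
                       (*-nonNeg (0≤+ 13) k-3≥0))
             (+-nonNeg (0≤+ 4) (*-nonNeg (0≤+ 8) (0≤+ v)))
  certificate : ∀ K V N →
    let a = + 2 * (K * K) - + 6 * K + + 4 * V
        b = (+ 2 * V - + 3) * (K * K) + (- (+ 2 * V) + + 5) * K + (- (+ 4 * V) + + 2)
        H = V * (V * (V - 1ℤ)) - + 2 * (V - 1ℤ) * N
        lhs = + 4 * V * N * ((K - 1ℤ) * (K - + 2))
        rhs = K * (K - + 3) * (+ 4 * (N * N) + V * V) + + 4 * V * K * (K - 1ℤ) * H + + 8 * V * (N * N)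
    in + 2 * (a * (N * N) - + 2 * b * V * N + + 2 * (V - 1ℤ) * ((V - + 2) * K * (K - 1ℤ) + + 2) * (V * V))
         ≡ (rhs - lhs) + + 4 * (+ 2 * K * (K - + 3) + + 4 * V) * V * (N - V * V)
           + V * V * ((+ 2 * K - + 4 * V) * (+ 2 * K - + 4 * V) + + 3 * ((K - + 3) * (K - + 3)) + + 13 * (K - + 3) + (+ 4 + + 8 * V))
  certificate = solve-∀

covering⇒v²≤N : ∀ {N k v} {A : Array N k v} → IsCoveringArray N k v A → 2 ℕ.≤ k → + v * + v ≤ + N
covering⇒v²≤N {A = A} covering (s≤s (s≤s _)) = distinct-columns⇒v²≤N A covering {zero} {suc zero} (λ ())

uca⇒quadraticForm-nonNeg : ∀ {N k v} .{{_ : NonZero v}} {A : Array N k v} → IsUCA N k v A →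
  2 ℕ.≤ k → 1 ℕ.≤ v → 0ℤ ≤ quadraticForm k v N
uca⇒quadraticForm-nonNeg {k = 1} _ (s≤s ()) _
uca⇒quadraticForm-nonNeg {N} {2} uca 2≤k 1≤v = quadraticForm-nonNeg-2 N 1≤v
uca⇒quadraticForm-nonNeg {N} {k@(suc (suc (suc _)))} {v} {A} uca@(covering , _) 2≤k 1≤v =
  countingBound⇒quadraticForm-nonNeg {k} {v} {N} 3≤k (covering⇒v²≤N covering 2≤k) (uca⇒countingBound A uca 3≤k)
  where
  3≤k : 3 ℕ.≤ k
  3≤k = s≤s (s≤s (s≤s z≤n))

corollary3 : (k v N : ℕ) → 2 ℕ.≤ k → 2 ℕ.≤ v → .{{_ : NonZero v}} →
    ∃ (λ (A : Array N k v) → IsUCA N k v A) →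
    (+ 0 ≤ + N * aQ k v - + v * bQ k v)
    × (+ v * + v * DQ k v ≤ (+ N * aQ k v - + v * bQ k v) * (+ N * aQ k v - + v * bQ k v))
corollary3 k v N 2≤k 2≤v (A , uca@(covering , _)) =
  margin-nonNeg 2≤k 1≤v (covering⇒v²≤N covering 2≤k) ,
  subst (+ v * + v * DQ k v ≤_) (sym (margin-square k v N))
        (i≤i+j _ _ {{nonNegative (*-nonNeg (aQ-nonNeg 2≤k 1≤v) (uca⇒quadraticForm-nonNeg uca 2≤k 1≤v))}})
  where
  1≤v : 1 ℕ.≤ v
  1≤v = ℕP.<⇒≤ 2≤v
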